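{- Let $a\colon \mathbb{N}_0 \to \Omega$ be a $k$-automatic sequence produced by an idempotent $k$-automaton $\mathcal{A} = (S,\Sigma_k,\delta,s_0,\Omega,\tau)$ which ignores the leading $0$'s and in which every state is accessible. Let $X_a$ be the subshift generated by $a$ and let $x \in \Omega$, identified with the constant word $x^\omega \in \Omega^\omega$. Then the following are equivalent: (1) $x^\omega \in X_a$; (2) there exists a strongly connected component $C$ of $\mathcal{A}$ such that $\tau(s) = x$ for all $s \in C$.
   Context: A $k$-automaton $(S,\Sigma_k,\delta,s_0,\Omega,\tau)$ is a deterministic finite automaton with output, input alphabet $\Sigma_k=\{0,\dots,k-1\}$, reading the base-$k$ expansion $(n)_k$ of $n$ (without leading zeros) from the most significant digit, producing $a(n) = \tau(\delta(s_0,(n)_k))$. A state $s$ is accessible if $s = \delta(s_0,v)$ for some word $v$. The automaton ignores the leading $0$'s if $\delta(s_0,0)=s_0$, and is idempotent if $\delta(s,00)=\delta(s,0)$ for all $s\in S$. A strongly connected component is a subset $C\subset S$ with $\delta(s,u)\in C$ for all $s\in C$, $u\in\Sigma_k$, such that any $s,s'\in C$ are connected by some word $w$ with $\delta(s,w)=s'$. $\Omega^\omega$ carries the product of discrete topologies, $\sigma$ is the left shift, and $X_a$ is the closure of $\{\sigma^n a : n \geq 0\}$. -}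

module Defs where

open import Data.Nat using (ℕ; zero; suc; _+_; _<_; _/_)
open import Data.Nat.DivMod using (_mod_)
open import Data.Fin using (Fin)
open import Data.List using (List; []; _∷_; foldl; reverse)
open import Data.Product using (Σ; ∃; _×_; _,_)
open import Relation.Binary.PropositionalEquality using (_≡_)

-- Throughout, the base is k = 2 + j (so k ≥ 2); digits are Fin k.

-- Base-k digits of n, least significant first, without leading zeros
-- (the fuel argument is ≥ the number of digits whenever fuel ≥ n).
digitsLSB : (j : ℕ) → (fuel n : ℕ) → List (Fin (2 + j))
digitsLSB j zero    n       = []
digitsLSB j (suc f) zero    = []
digitsLSB j (suc f) (suc n) = (suc n mod (2 + j)) ∷ digitsLSB j f (suc n / (2 + j))

-- (n)_k : base-k expansion of n, most significant digit first, no leading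
-- zeros; (0)_k is the empty word.
expansion : (j : ℕ) → ℕ → List (Fin (2 + j))
expansion j n = reverse (digitsLSB j n n)

record Automaton (j : ℕ) (Ω : Set) : Set where
  field
    m  : ℕ
    δ  : Fin m → Fin (2 + j) → Fin m
    s₀ : Fin m
    τ  : Fin m → Ω

  δ* : Fin m → List (Fin (2 + j)) → Fin m
  δ* s w = foldl δ s w

  seq : ℕ → Ω
  seq n = τ (δ* s₀ (expansion j n))

  IgnoresLeadingZeros : Set
  IgnoresLeadingZeros = δ s₀ Fin.zero ≡ s₀

  Idempotent : Set
  Idempotent = ∀ (s : Fin m) → δ (δ s Fin.zero) Fin.zero ≡ δ s Fin.zero

  Accessible : Fin m → Set
  Accessible s = Σ (List (Fin (2 + j))) λ v → δ* s₀ v ≡ s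

  AllAccessible : Set
  AllAccessible = ∀ (s : Fin m) → Accessible s

  IsSCC : (Fin m → Set) → Set
  IsSCC C = (Σ (Fin m) C)
          × (∀ s → C s → ∀ (u : Fin (2 + j)) → C (δ s u))
          × (∀ s s' → C s → C s' → Σ (List (Fin (2 + j))) λ w → δ* s w ≡ s')

-- y ∈ X_a (closure of the shift orbit of a in Ω^ω, product of discrete
-- topologies): every cylinder neighbourhood of y meets the orbit, i.e. for
-- each N some shift σ^n a agrees with y on the first N coordinates.
InSubshift : {Ω : Set} → (ℕ → Ω) → (ℕ → Ω) → Set
InSubshift a y = ∀ (N : ℕ) → ∃ λ (n : ℕ) → ∀ (i : ℕ) → i < N → a (n + i) ≡ y i

const-word : {Ω : Set} → Ω → ℕ → Ω
const-word x _ = x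

-- If x^ω ∈ X_a, then a is constantly x on a window of length 2 k^(m+1), which contains a whole
-- block [M k^(m+1), (M+1) k^(m+1)): every word of length m + 1 read from the state t reached on M
-- leads to an x-labelled state. By pigeonhole every state reachable from δ(t, 0) is reachable by a
-- word of length ≤ m, and idempotence lets such a word be padded on the left with zeros to length
-- m + 1, so all these states are labelled x; the states reachable from a terminal state among them
-- form the required component. Conversely, if C is such a component and (V)_k leads into C, then
-- every number in [V k^N, (V+1) k^N) leads into C, giving runs of x of every length N.

module Submission where

open import Defs
open import Data.Bool.Properties using (T-≡)
open import Data.Fin as Fin using (Fin; toℕ)
open import Data.Fin.Properties using (toℕ-injective; toℕ-fromℕ<; toℕ<n; pigeonhole; any?; all?; ¬∀⟶∃¬)
open import Data.Fin.Subset using (Subset; _∈_; _⊂_)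
open import Data.Fin.Subset.Induction using (⊂-wellFounded)
open import Data.List using (List; []; _∷_; foldl; reverse; _++_; _∷ʳ_; length; take; drop; replicate)
open import Data.List.Properties using (foldl-++; foldl-∷ʳ; length-++; length-take; length-drop; take++drop≡id; length-replicate; unfold-reverse)
open import Data.Nat using (ℕ; zero; suc; _+_; _*_; _∸_; _^_; _⊓_; _≤_; _<_; _/_; _%_; _≤?_; z≤n; s≤s; s≤s⁻¹; NonZero)
open import Data.Nat.DivMod
open import Data.Nat.Divisibility using (n∣m*n)
open import Data.Nat.Induction using (<-wellFounded)
open import Data.Nat.Properties
open import Data.Nat.Tactic.RingSolver using (solve-∀)
open import Data.Product using (Σ; ∃; _×_; _,_; proj₁; proj₂)
open import Data.Vec using (tabulate)
open import Data.Vec.Properties using (lookup∘tabulate; lookup⇒[]=; []=⇒lookup)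
open import Function.Base using (_∘_; _on_)
open import Function.Bundles using (_⇔_; mk⇔; Equivalence)
open import Induction.WellFounded using (Acc; acc)
open import Relation.Binary.Construct.On as On using ()
open import Relation.Binary.PropositionalEquality
open import Relation.Nullary using (Dec; yes; no; ¬_; contradiction)
open import Relation.Nullary.Decidable using (_→-dec_; ⌊_⌋; toWitness; fromWitness; decidable-stable)

module BaseExpansion (j : ℕ) where

  k : ℕ
  k = 2 + j

  digitsLSB-zero : ∀ f → digitsLSB j f 0 ≡ []
  digitsLSB-zero zero    = refl
  digitsLSB-zero (suc f) = refl

  digitsLSB-fuel : ∀ f g n → n ≤ f → n ≤ g → digitsLSB j f n ≡ digitsLSB j g n
  digitsLSB-fuel f       g       zero    _         _         =
    trans (digitsLSB-zero f) (sym (digitsLSB-zero g))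
  digitsLSB-fuel (suc f) (suc g) (suc n) (s≤s n≤f) (s≤s n≤g) =
    cong (suc n mod k ∷_) (digitsLSB-fuel f g (suc n / k) (≤-trans q≤n n≤f) (≤-trans q≤n n≤g))
    where
    q≤n : suc n / k ≤ n
    q≤n = s≤s⁻¹ (m/n<m (suc n) k (s≤s (s≤s z≤n)))

  [n*k+d]/k≡n : ∀ n (d : Fin k) → (n * k + toℕ d) / k ≡ n
  [n*k+d]/k≡n n d = begin
    (n * k + toℕ d) / k    ≡⟨ +-distrib-/-∣ˡ (toℕ d) (n∣m*n n) ⟩
    n * k / k + toℕ d / k  ≡⟨ cong₂ _+_ (m*n/n≡m n k) (m<n⇒m/n≡0 (toℕ<n d)) ⟩
    n + 0                  ≡⟨ +-identityʳ n ⟩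
    n                      ∎
    where open ≡-Reasoning

  [n*k+d]mod-k≡d : ∀ n (d : Fin k) → (n * k + toℕ d) mod k ≡ d
  [n*k+d]mod-k≡d n d = toℕ-injective (begin
    toℕ ((n * k + toℕ d) mod k)  ≡⟨ toℕ-fromℕ< _ ⟩
    (n * k + toℕ d) % k          ≡⟨ cong (_% k) (+-comm (n * k) (toℕ d)) ⟩
    (toℕ d + n * k) % k          ≡⟨ [m+kn]%n≡m%n (toℕ d) n k ⟩
    toℕ d % k                    ≡⟨ m<n⇒m%n≡m (toℕ<n d) ⟩
    toℕ d                        ∎)
    where open ≡-Reasoning

  expansion-∷ʳ : ∀ n (d : Fin k) {p} → n * k + toℕ d ≡ suc p →
                 expansion j (n * k + toℕ d) ≡ expansion j n ∷ʳ d
  expansion-∷ʳ n d {p} eq rewrite eq = begin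
    reverse (suc p mod k ∷ digitsLSB j p (suc p / k))
      ≡⟨ cong₂ (λ e q → reverse (e ∷ digitsLSB j p q)) remainder quotient ⟩
    reverse (d ∷ digitsLSB j p n)
      ≡⟨ cong (reverse ∘ (d ∷_)) (digitsLSB-fuel p n n n≤p ≤-refl) ⟩
    reverse (d ∷ digitsLSB j n n)
      ≡⟨ unfold-reverse d (digitsLSB j n n) ⟩
    expansion j n ∷ʳ d ∎
    where
    open ≡-Reasoning
    quotient : suc p / k ≡ n
    quotient = trans (cong (_/ k) (sym eq)) ([n*k+d]/k≡n n d)
    remainder : suc p mod k ≡ d
    remainder = trans (cong (_mod k) (sym eq)) ([n*k+d]mod-k≡d n d)
    n≤p : n ≤ p
    n≤p = s≤s⁻¹ (subst (_< suc p) quotient (m/n<m (suc p) k (s≤s (s≤s z≤n))))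

  appendDigits : ℕ → List (Fin k) → ℕ
  appendDigits M u = foldl (λ a d → a * k + toℕ d) M u

  appendDigits-lower : ∀ M u → M * k ^ length u ≤ appendDigits M u
  appendDigits-lower M []      = ≤-reflexive (*-identityʳ M)
  appendDigits-lower M (d ∷ u) = begin
    M * (k * k ^ length u)            ≡⟨ *-assoc M k (k ^ length u) ⟨
    M * k * k ^ length u              ≤⟨ *-monoˡ-≤ (k ^ length u) (m≤m+n (M * k) (toℕ d)) ⟩
    (M * k + toℕ d) * k ^ length u    ≤⟨ appendDigits-lower (M * k + toℕ d) u ⟩
    appendDigits M (d ∷ u)            ∎
    where open ≤-Reasoning

  appendDigits-upper : ∀ M u → appendDigits M u < suc M * k ^ length u
  appendDigits-upper M []      = s≤s (≤-reflexive (sym (*-identityʳ M)))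
  appendDigits-upper M (d ∷ u) = begin-strict
    appendDigits M (d ∷ u)                 <⟨ appendDigits-upper (M * k + toℕ d) u ⟩
    suc (M * k + toℕ d) * k ^ length u     ≤⟨ *-monoˡ-≤ (k ^ length u) digit-bound ⟩
    suc M * k * k ^ length u               ≡⟨ *-assoc (suc M) k (k ^ length u) ⟩
    suc M * (k * k ^ length u)             ∎
    where
    open ≤-Reasoning
    digit-bound : suc (M * k + toℕ d) ≤ suc M * k
    digit-bound = begin
      suc (M * k + toℕ d)  ≡⟨ +-suc (M * k) (toℕ d) ⟨
      M * k + suc (toℕ d)  ≤⟨ +-monoʳ-≤ (M * k) (toℕ<n d) ⟩
      M * k + k            ≡⟨ +-comm (M * k) k ⟩
      suc M * k            ∎

  V*k^[1+L]+i≡[V*k^L+i/k]*k+i%k : ∀ V L i →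
    V * k ^ suc L + i ≡ (V * k ^ L + i / k) * k + toℕ (i mod k)
  V*k^[1+L]+i≡[V*k^L+i/k]*k+i%k V L i = begin
    V * k ^ suc L + i                      ≡⟨ cong (V * k ^ suc L +_) (m≡m%n+[m/n]*n i k) ⟩
    V * (k * k ^ L) + (i % k + i / k * k)  ≡⟨ regroup V k (k ^ L) (i / k) (i % k) ⟩
    (V * k ^ L + i / k) * k + i % k        ≡⟨ cong ((V * k ^ L + i / k) * k +_) (toℕ-fromℕ< (m%n<n i k)) ⟨
    (V * k ^ L + i / k) * k + toℕ (i mod k) ∎
    where
    open ≡-Reasoning
    regroup : ∀ V k P q r → V * (k * P) + (r + q * k) ≡ (V * P + q) * k + r
    regroup = solve-∀

  n<k^n : ∀ n → n < k ^ n
  n<k^n zero    = s≤s z≤n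
  n<k^n (suc n) = begin-strict
    suc n                      <⟨ +-mono-≤ (m^n>0 k n) (n<k^n n) ⟩
    k ^ n + k ^ n              ≤⟨ +-monoʳ-≤ (k ^ n) (m≤m+n (k ^ n) (j * k ^ n)) ⟩
    k ^ suc n                  ∎
    where open ≤-Reasoning

block⊆window : ∀ n K .{{_ : NonZero K}} {V} →
  suc (n / K) * K ≤ V → V < suc (suc (n / K)) * K → n ≤ V × V ∸ n < K + K
block⊆window n K {V} MK≤V V<[M+1]K = n≤V , V∸n<2K
  where
  open ≤-Reasoning
  n≤V : n ≤ V
  n≤V = <⇒≤ (begin-strict
    n                    ≡⟨ m≡m%n+[m/n]*n n K ⟩
    n % K + n / K * K    <⟨ +-monoˡ-< (n / K * K) (m%n<n n K) ⟩
    suc (n / K) * K      ≤⟨ MK≤V ⟩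
    V                    ∎)
  V∸n<2K : V ∸ n < K + K
  V∸n<2K = begin-strict
    V ∸ n                      <⟨ ∸-monoˡ-< V<n+2K n≤V ⟩
    n + (K + K) ∸ n            ≡⟨ m+n∸m≡n n (K + K) ⟩
    K + K                      ∎
    where
    V<n+2K : V < n + (K + K)
    V<n+2K = begin-strict
      V                         <⟨ V<[M+1]K ⟩
      K + (K + n / K * K)       ≤⟨ +-monoʳ-≤ K (+-monoʳ-≤ K (m/n*n≤m n K)) ⟩
      K + (K + n)               ≡⟨ +-comm K (K + n) ⟩
      K + n + K                 ≡⟨ cong (_+ K) (+-comm K n) ⟩
      n + K + K                 ≡⟨ +-assoc n K K ⟩
      n + (K + K)               ∎

module Reachability {m n : ℕ} (δ : Fin m → Fin n → Fin m) where

  δ* : Fin m → List (Fin n) → Fin m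
  δ* = foldl δ

  Reachable : Fin m → Fin m → Set
  Reachable a b = Σ (List (Fin n)) λ w → δ* a w ≡ b

  ReachableWithin : ℕ → Fin m → Fin m → Set
  ReachableWithin ℓ a b = Σ (List (Fin n)) λ w → length w ≤ ℓ × δ* a w ≡ b

  reachable-refl : ∀ {a} → Reachable a a
  reachable-refl = [] , refl

  reachable-trans : ∀ {a b c} → Reachable a b → Reachable b c → Reachable a c
  reachable-trans {a} (v , refl) (w , refl) = v ++ w , foldl-++ δ a v w

  reachable-step : ∀ {a b} → Reachable a b → ∀ d → Reachable a (δ b d)
  reachable-step (w , ab) d = reachable-trans (w , ab) (d ∷ [] , refl)

  -- Two of the m + 1 shortest prefixes of w reach the same state; cut out the loop between them.
  shorten-loop : ∀ a w → m < length w → Σ (List (Fin n)) λ w' → length w' < length w × δ* a w' ≡ δ* a w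
  shorten-loop a w m<|w| with pigeonhole (n<1+n m) (λ i → δ* a (take (toℕ i) w))
  ... | i , i' , i<i' , loop = take I w ++ drop I' w , shorter , same-end
    where
    I = toℕ i
    I' = toℕ i'
    I'≤|w| : I' ≤ length w
    I'≤|w| = ≤-trans (s≤s⁻¹ (toℕ<n i')) (<⇒≤ m<|w|)
    shorter : length (take I w ++ drop I' w) < length w
    shorter = begin-strict
      length (take I w ++ drop I' w)           ≡⟨ length-++ (take I w) ⟩
      length (take I w) + length (drop I' w)   ≡⟨ cong₂ _+_ (length-take I w) (length-drop I' w) ⟩
      I ⊓ length w + (length w ∸ I')           ≤⟨ +-monoˡ-≤ (length w ∸ I') (m⊓n≤m I (length w)) ⟩
      I + (length w ∸ I')                      <⟨ +-monoˡ-< (length w ∸ I') i<i' ⟩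
      I' + (length w ∸ I')                     ≡⟨ m+[n∸m]≡n I'≤|w| ⟩
      length w                                 ∎
      where open ≤-Reasoning
    same-end : δ* a (take I w ++ drop I' w) ≡ δ* a w
    same-end = begin
      δ* a (take I w ++ drop I' w)             ≡⟨ foldl-++ δ a (take I w) (drop I' w) ⟩
      δ* (δ* a (take I w)) (drop I' w)         ≡⟨ cong (λ s → δ* s (drop I' w)) loop ⟩
      δ* (δ* a (take I' w)) (drop I' w)        ≡⟨ foldl-++ δ a (take I' w) (drop I' w) ⟨
      δ* a (take I' w ++ drop I' w)            ≡⟨ cong (δ* a) (take++drop≡id I' w) ⟩
      δ* a w                                   ∎
      where open ≡-Reasoning

  reachable⇒reachableWithin : ∀ {a b} → Reachable a b → ReachableWithin m a b
  reachable⇒reachableWithin {a} (w , refl) = go w (<-wellFounded (length w))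
    where
    go : ∀ w → Acc _<_ (length w) → ReachableWithin m a (δ* a w)
    go w _ with length w ≤? m
    go w _        | yes |w|≤m = w , |w|≤m , refl
    go w (acc rs) | no  |w|≰m with shorten-loop a w (≰⇒> |w|≰m)
    ... | w' , shorter , same-end with go w' (rs shorter)
    ...   | v , |v|≤m , v-end = v , |v|≤m , trans v-end same-end

  reachableWithin? : ∀ ℓ a b → Dec (ReachableWithin ℓ a b)
  reachableWithin? ℓ a b with a Fin.≟ b
  ... | yes a≡b = yes ([] , z≤n , a≡b)
  reachableWithin? zero a b | no a≢b =
    no λ { ([] , _ , a≡b) → a≢b a≡b ; (_ ∷ _ , () , _) }
  reachableWithin? (suc ℓ) a b | no a≢b with any? (λ d → reachableWithin? ℓ (δ a d) b)
  ... | yes (d , w , |w|≤ℓ , e) = yes (d ∷ w , s≤s |w|≤ℓ , e)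
  ... | no ¬step = no λ { ([] , _ , a≡b) → a≢b a≡b
                        ; (d ∷ w , |dw|≤1+ℓ , e) → ¬step (d , w , s≤s⁻¹ |dw|≤1+ℓ , e) }

  closed⇒reachable-closed : {C : Fin m → Set} → (∀ s → C s → ∀ d → C (δ s d)) →
                            ∀ {a b} → C a → Reachable a b → C b
  closed⇒reachable-closed {C} closed {a} a∈C (w , refl) = go a w a∈C
    where
    go : ∀ a w → C a → C (δ* a w)
    go a []      a∈C = a∈C
    go a (d ∷ w) a∈C = go (δ a d) w (closed a a∈C d)

  reachable? : ∀ a b → Dec (Reachable a b)
  reachable? a b with reachableWithin? m a b
  ... | yes (w , _ , e) = yes (w , e)
  ... | no ¬within      = no (¬within ∘ reachable⇒reachableWithin)

  Terminal : Fin m → Set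
  Terminal z = ∀ s → Reachable z s → Reachable s z

  terminal? : ∀ z → Dec (Terminal z)
  terminal? z = all? (λ s → reachable? z s →-dec reachable? s z)

  ¬terminal⇒escape : ∀ {z} → ¬ Terminal z → ∃ λ s → Reachable z s × ¬ Reachable s z
  ¬terminal⇒escape {z} ¬term
    with s , ¬back ← ¬∀⟶∃¬ m _ (λ s → reachable? z s →-dec reachable? s z) ¬term =
    s , decidable-stable (reachable? z s) (λ ¬zs → ¬back (λ zs → contradiction zs ¬zs))
      , λ sz → ¬back (λ _ → sz)

  reachableSet : Fin m → Subset m
  reachableSet a = tabulate (λ b → ⌊ reachable? a b ⌋)

  ∈reachableSet⁺ : ∀ {a b} → Reachable a b → b ∈ reachableSet a
  ∈reachableSet⁺ {a} {b} ab =
    lookup⇒[]= b _ (trans (lookup∘tabulate _ b) (Equivalence.to T-≡ (fromWitness ab)))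

  ∈reachableSet⁻ : ∀ {a b} → b ∈ reachableSet a → Reachable a b
  ∈reachableSet⁻ {a} {b} b∈ =
    toWitness (Equivalence.from T-≡ (trans (sym (lookup∘tabulate _ b)) ([]=⇒lookup b∈)))

  escape⇒reachableSet-⊂ : ∀ {z s} → Reachable z s → ¬ Reachable s z → reachableSet s ⊂ reachableSet z
  escape⇒reachableSet-⊂ zs ¬sz =
    (∈reachableSet⁺ ∘ reachable-trans zs ∘ ∈reachableSet⁻) , _ , ∈reachableSet⁺ reachable-refl , ¬sz ∘ ∈reachableSet⁻

  reaches-terminal : ∀ a → ∃ λ z → Reachable a z × Terminal z
  reaches-terminal a = go a (On.wellFounded reachableSet ⊂-wellFounded a)
    where
    go : ∀ a → Acc (_⊂_ on reachableSet) a → ∃ λ z → Reachable a z × Terminal z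
    go a (acc rs) with terminal? a
    ... | yes term = a , reachable-refl , term
    ... | no ¬term with s , as , ¬sa ← ¬terminal⇒escape ¬term
                   with z , sz , term ← go s (rs (escape⇒reachableSet-⊂ as ¬sa)) =
      z , reachable-trans as sz , term

module AutomaticSequence {j : ℕ} {Ω : Set} (A : Automaton j Ω)
                         (leading-zeros : Automaton.IgnoresLeadingZeros A) where

  open Automaton A
  open BaseExpansion j
  open Reachability δ hiding (δ*)

  state : ℕ → Fin m
  state n = δ* s₀ (expansion j n)

  state-step : ∀ n d → state (n * k + toℕ d) ≡ δ (state n) d
  state-step zero    Fin.zero    = sym leading-zeros
  state-step zero    (Fin.suc d) =
    trans (cong (δ* s₀) (expansion-∷ʳ 0 (Fin.suc d) refl)) (foldl-∷ʳ δ s₀ (Fin.suc d) [])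
  state-step (suc n) d           =
    trans (cong (δ* s₀) (expansion-∷ʳ (suc n) d refl)) (foldl-∷ʳ δ s₀ d (expansion j (suc n)))

  state-appendDigits : ∀ M u → state (appendDigits M u) ≡ δ* (state M) u
  state-appendDigits M []      = refl
  state-appendDigits M (d ∷ u) =
    trans (state-appendDigits (M * k + toℕ d) u) (cong (λ s → δ* s u) (state-step M d))

  state-block : ∀ V L i → i < k ^ L → Reachable (state V) (state (V * k ^ L + i))
  state-block V zero    zero    _          = [] , cong state (sym (trans (+-identityʳ _) (*-identityʳ V)))
  state-block V zero    (suc i) (s≤s ())
  state-block V (suc L) i       i<k^[1+L] =
    subst (Reachable (state V)) (sym last-digit) (reachable-step (state-block V L (i / k) i/k<k^L) (i mod k))
    where
    i/k<k^L : i / k < k ^ L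
    i/k<k^L = m<n*o⇒m/o<n (subst (i <_) (*-comm k (k ^ L)) i<k^[1+L])
    last-digit : state (V * k ^ suc L + i) ≡ δ (state (V * k ^ L + i / k)) (i mod k)
    last-digit = trans (cong state (V*k^[1+L]+i≡[V*k^L+i/k]*k+i%k V L i))
                       (state-step (V * k ^ L + i / k) (i mod k))

  terminal⇒reachable-isSCC : ∀ {z} → Terminal z → IsSCC (Reachable z)
  terminal⇒reachable-isSCC term =
    (_ , reachable-refl) , (λ _ zs → reachable-step zs) , λ s _ zs zs' → reachable-trans (term s zs) zs'

  UniformSCC : Ω → Set₁
  UniformSCC x = Σ (Fin m → Set) λ C → IsSCC C × (∀ s → C s → τ s ≡ x)

  zeros-idempotent : Idempotent → ∀ r s → δ* s (replicate (suc r) Fin.zero) ≡ δ s Fin.zero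
  zeros-idempotent idem zero    s = refl
  zeros-idempotent idem (suc r) s =
    trans (cong (λ s' → δ* s' (replicate r Fin.zero)) (idem s)) (zeros-idempotent idem r s)

  constant-run⇒uniform-words : ∀ {x} n L → (∀ i → i < k ^ L + k ^ L → seq (n + i) ≡ x) →
    ∃ λ t → ∀ u → length u ≡ L → τ (δ* t u) ≡ x
  constant-run⇒uniform-words {x} n L run = state M , uniform
    where
    K = k ^ L
    instance
      K≢0 : NonZero K
      K≢0 = m^n≢0 k L
    M = suc (n / K)
    uniform : ∀ u → length u ≡ L → τ (δ* (state M) u) ≡ x
    uniform u |u|≡L with block⊆window n K (subst (λ l → M * k ^ l ≤ appendDigits M u) |u|≡L (appendDigits-lower M u))
                                          (subst (λ l → appendDigits M u < suc M * k ^ l) |u|≡L (appendDigits-upper M u))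
    ... | n≤V , V∸n<2K = begin
      τ (δ* (state M) u)                ≡⟨ cong τ (state-appendDigits M u) ⟨
      seq (appendDigits M u)            ≡⟨ cong seq (m+[n∸m]≡n n≤V) ⟨
      seq (n + (appendDigits M u ∸ n))  ≡⟨ run _ V∸n<2K ⟩
      x                                 ∎
      where open ≡-Reasoning

  uniform-words⇒uniform-reachable : Idempotent → ∀ {t x} → (∀ u → length u ≡ suc m → τ (δ* t u) ≡ x) →
    ∀ {s} → Reachable (δ t Fin.zero) s → τ s ≡ x
  uniform-words⇒uniform-reachable idem {t} {x} uniform r with reachable⇒reachableWithin r
  ... | w , |w|≤m , refl = subst (λ s → τ s ≡ x) padded (uniform (zeros ++ w) |zeros++w|≡1+m)
    where
    zeros = replicate (suc (m ∸ length w)) Fin.zero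
    padded : δ* t (zeros ++ w) ≡ δ* (δ t Fin.zero) w
    padded = trans (foldl-++ δ t zeros w) (cong (λ s → δ* s w) (zeros-idempotent idem (m ∸ length w) t))
    |zeros++w|≡1+m : length (zeros ++ w) ≡ suc m
    |zeros++w|≡1+m = trans (length-++ zeros)
      (cong suc (trans (cong (_+ length w) (length-replicate (m ∸ length w))) (m∸n+n≡m |w|≤m)))

  const∈subshift⇒uniformSCC : Idempotent → ∀ x → InSubshift seq (const-word x) → UniformSCC x
  const∈subshift⇒uniformSCC idem x inSubshift
    with n , run ← inSubshift (k ^ suc m + k ^ suc m)
    with t , uniform ← constant-run⇒uniform-words n (suc m) run
    with z , tz , term ← reaches-terminal (δ t Fin.zero) =
    Reachable z , terminal⇒reachable-isSCC term ,
    λ s zs → uniform-words⇒uniform-reachable idem uniform (reachable-trans tz zs)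

  uniformSCC⇒const∈subshift : AllAccessible → ∀ x → UniformSCC x → InSubshift seq (const-word x)
  uniformSCC⇒const∈subshift accessible x (C , ((s , s∈C) , closed , _) , τ≡x) N =
    V * k ^ N , λ i i<N →
      τ≡x _ (closed⇒reachable-closed closed V∈C (state-block V N i (<-trans i<N (n<k^n N))))
    where
    v = proj₁ (accessible s)
    V = appendDigits 0 v
    V∈C : C (state V)
    V∈C = subst C (sym (trans (state-appendDigits 0 v) (proj₂ (accessible s)))) s∈C

lemma2p3 : (j : ℕ) (Ω : Set) (A : Automaton j Ω) →
    Automaton.Idempotent A → Automaton.IgnoresLeadingZeros A → Automaton.AllAccessible A →
    (x : Ω) →
    InSubshift (Automaton.seq A) (const-word x)
      ⇔ Σ (Fin (Automaton.m A) → Set) (λ C →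
          Automaton.IsSCC A C × (∀ s → C s → Automaton.τ A s ≡ x))
lemma2p3 j Ω A idempotent leading-zeros accessible x =
  mk⇔ (const∈subshift⇒uniformSCC idempotent x) (uniformSCC⇒const∈subshift accessible x)
  where open AutomaticSequence A leading-zeros
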